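{- Suppose a positive integer $N$ admits three decompositions as sums of three positive integers, $$N = (N-i-j) + i + j,\qquad N = a_1+a_2+a_3,\qquad N = b_1+b_2+b_3,$$ (with $i, j, N-i-j, a_1,a_2,a_3,b_1,b_2,b_3$ positive integers) such that for every prime $p$ dividing $N(N-1)(N-2)$, at least one of these three decompositions is $p$-acceptable. Then it is not the case that $2 < i + j < 11$.
   Context: For a prime $p$, a decomposition $N = c_1 + \dots + c_k$ of a positive integer $N$ as a sum of positive integers is called $p$-acceptable if the multinomial coefficient $N!/(c_1!\cdots c_k!)$ is not divisible by $p$; equivalently, for each $t\ge 0$, the coefficient of $p^t$ in the base-$p$ expansion of $N$ equals the sum of the coefficients of $p^t$ in the base-$p$ expansions of $c_1,\dots,c_k$ (no carrying in base $p$). -}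

module Defs where

open import Data.Nat using (ℕ; _*_; _/_; _!; NonZero)
open import Data.Nat.Properties using (_!≢0; m*n≢0)
open import Data.Nat.Divisibility using (_∣_)
open import Data.List using (List; []; _∷_)
open import Data.Nat.ListAction using (sum)
open import Relation.Nullary using (¬_)

factProd : List ℕ → ℕ
factProd []       = 1
factProd (c ∷ cs) = c ! * factProd cs

factProd≢0 : ∀ cs → NonZero (factProd cs)
factProd≢0 []       = _
factProd≢0 (c ∷ cs) = m*n≢0 (c !) (factProd cs) {{c !≢0}} {{factProd≢0 cs}}

multinomial : List ℕ → ℕ
multinomial cs = (sum cs ! / factProd cs) {{factProd≢0 cs}}

pAcceptable : ℕ → List ℕ → Set
pAcceptable p cs = ¬ (p ∣ multinomial cs)

{-# OPTIONS --safe #-}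
-- Write W = N³(N − 1)²(N − 2). By Kummer's theorem a p-acceptable decomposition N = x + y + z
-- has no carries in base p: the residues of x, y, z modulo every pᵗ add up to that of N. For each
-- prime p at most one of N, N − 1, N − 2 is divisible by p (or p = 2 divides N and N − 2), and
-- the residue of N modulo the relevant power of p then forces the p-part of W to divide xyz; for
-- the decomposition (N − i − j, i, j) with i, j small it divides instead a constant E(i, j) from a
-- finite table. Hence W divides a₁a₂a₃ · b₁b₂b₃ · E(i, j) ≤ (N/3)⁶ E(i, j) by AM–GM, i.e.
-- 729 (N − 1)²(N − 2) ≤ N³ E(i, j), which fails for every N > i + j when 2 < i + j < 11.
module Submission where

open import Defs
open import Data.Nat
open import Data.Nat.Properties
open import Data.Nat.Divisibility
open import Data.Nat.DivMod
open import Data.Nat.Primality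
open import Data.Nat.Primality.Factorisation using (factorise)
open import Data.List.Relation.Unary.All using (All; []; _∷_)
open import Data.Nat.Induction using (<-rec)
open import Data.Nat.Combinatorics using (k![n∸k]!∣n!)
open import Data.Nat.ListAction using (sum; product)
open import Data.Nat.Tactic.RingSolver using (solve-∀)
open import Data.List using (List; []; _∷_; map)
open import Data.List.Properties using (map-cong; map-∘)
open import Data.Product using (_×_; _,_; proj₁; proj₂; ∃; ∃₂)
open import Data.Sum using (_⊎_; inj₁; inj₂; [_,_]′)
open import Data.Empty using (⊥; ⊥-elim)
open import Relation.Nullary using (¬_; Dec; yes; no; contradiction; ¬?)
open import Relation.Nullary.Decidable using (_×-dec_; _→-dec_; toWitness)
open import Relation.Binary.PropositionalEquality
open import Function using (_∘_)

m!*n!∣[m+n]! : ∀ m n → m ! * n ! ∣ (m + n) !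
m!*n!∣[m+n]! m n = subst (λ k → m ! * k ! ∣ (m + n) !) (m+n∸m≡n m n) (k![n∸k]!∣n! (m≤m+n m n))

factProd∣sum! : ∀ cs → factProd cs ∣ sum cs !
factProd∣sum! []       = ∣-refl
factProd∣sum! (c ∷ cs) = ∣-trans (*-monoʳ-∣ (c !) (factProd∣sum! cs)) (m!*n!∣[m+n]! c (sum cs))

multinomial*factProd≡sum! : ∀ cs → multinomial cs * factProd cs ≡ sum cs !
multinomial*factProd≡sum! cs = m/n*n≡m {{factProd≢0 cs}} (factProd∣sum! cs)

sum-map-linear : ∀ (f g : ℕ → ℕ) k cs →
                 sum (map (λ x → f x + k * g x) cs) ≡ sum (map f cs) + k * sum (map g cs)
sum-map-linear f g k []       = sym (*-zeroʳ k)
sum-map-linear f g k (c ∷ cs) =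
  trans (cong (f c + k * g c +_) (sum-map-linear f g k cs)) (regroup (f c) (g c) k _ _)
  where
  regroup : ∀ a b k s t → a + k * b + (s + k * t) ≡ a + s + k * (b + t)
  regroup = solve-∀

[r+q*d]%d≡r : ∀ {d} .{{_ : NonZero d}} r q → r < d → (r + q * d) % d ≡ r
[r+q*d]%d≡r {d} r q r<d = trans ([m+kn]%n≡m%n r q d) (m<n⇒m%n≡m r<d)

[r+q*d]/d≡q : ∀ {d} .{{_ : NonZero d}} r q → r < d → (r + q * d) / d ≡ q
[r+q*d]/d≡q {d} r q r<d = begin
  (r + q * d) / d    ≡⟨ +-distrib-/-∣ʳ r (divides-refl q) ⟩
  r / d + q * d / d  ≡⟨ cong₂ _+_ (m<n⇒m/n≡0 r<d) (m*n/n≡m q d) ⟩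
  q                  ∎
  where open ≡-Reasoning

r+d*s<d*e : ∀ {r s d e} → r < d → s < e → r + d * s < d * e
r+d*s<d*e {r} {s} {d} {e} r<d s<e = begin-strict
  r + d * s  <⟨ +-monoˡ-< (d * s) r<d ⟩
  d + d * s  ≡⟨ *-suc d s ⟨
  d * suc s  ≤⟨ *-monoʳ-≤ d s<e ⟩
  d * e      ∎
  where open ≤-Reasoning

m^n∣m^o : ∀ m {n o} → n ≤ o → m ^ n ∣ m ^ o
m^n∣m^o m {n} {o} n≤o =
  divides (m ^ (o ∸ n)) (trans (cong (m ^_) (sym (m∸n+n≡m n≤o))) (^-distribˡ-+-* m (o ∸ n) n))

2∣n⊎2∣1+n : ∀ n → 2 ∣ n ⊎ 2 ∣ suc n
2∣n⊎2∣1+n zero    = inj₁ (divides 0 refl)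
2∣n⊎2∣1+n (suc n) with 2∣n⊎2∣1+n n
... | inj₁ (divides k n≡k*2) = inj₂ (divides (suc k) (cong (2 +_) n≡k*2))
... | inj₂ 2∣1+n             = inj₁ 2∣1+n

odd⇒1+2k : ∀ {u} → ¬ 2 ∣ u → ∃ λ k → u ≡ suc (k * 2)
odd⇒1+2k {zero}  2∤0 = contradiction (divides 0 refl) 2∤0
odd⇒1+2k {suc m} 2∤u with 2∣n⊎2∣1+n m
... | inj₁ (divides k m≡k*2) = k , cong suc m≡k*2
... | inj₂ 2∣u               = contradiction 2∣u 2∤u

p^t∣m*n⇒p^t∣n : ∀ {p} → Prime p → ∀ t {m n} → ¬ p ∣ m → p ^ t ∣ m * n → p ^ t ∣ n
p^t∣m*n⇒p^t∣n         p-prime zero    p∤m _ = 1∣ _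
p^t∣m*n⇒p^t∣n {p} p-prime (suc t) {m} {n} p∤m p^[1+t]∣mn
  with euclidsLemma m n p-prime (∣-trans (∣m⇒∣m*n (p ^ t) ∣-refl) p^[1+t]∣mn)
... | inj₁ p∣m          = contradiction p∣m p∤m
... | inj₂ (divides k refl) = subst (p * p ^ t ∣_) (*-comm p k) (*-monoʳ-∣ p
      (p^t∣m*n⇒p^t∣n p-prime t p∤m (*-cancelˡ-∣ p {{prime⇒nonZero p-prime}}
        (subst (p * p ^ t ∣_) (regroup m k p) p^[1+t]∣mn))))
  where
  regroup : ∀ m k p → m * (k * p) ≡ p * (m * k)
  regroup = solve-∀

∣-byPrimePowers : ∀ {Q R} .{{_ : NonZero Q}} →
                  (∀ p t → Prime p → p ^ t ∣ Q → p ^ t ∣ R) → Q ∣ R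
∣-byPrimePowers {Q} {R} H with factorise Q
... | record { factors = fs ; isFactorisation = refl ; factorsPrime = fs-prime } = go fs fs-prime H
  where
  go : ∀ fs {R} → All Prime fs → (∀ p t → Prime p → p ^ t ∣ product fs → p ^ t ∣ R) →
       product fs ∣ R
  go []       _                    _ = 1∣ _
  go (f ∷ fs) (f-prime ∷ fs-prime) H
    with ∣-trans (m∣m*n {f} 1) (H f 1 f-prime (*-monoʳ-∣ f (1∣ product fs)))
  ... | divides R′ refl = subst (f * product fs ∣_) (*-comm f R′) (*-monoʳ-∣ f (go fs fs-prime H′))
    where
    H′ : ∀ p t → Prime p → p ^ t ∣ product fs → p ^ t ∣ R′
    H′ p t p-prime p^t∣fs with p ≟ f
    ... | yes refl = *-cancelˡ-∣ p {{prime⇒nonZero p-prime}} (subst (p * p ^ t ∣_) (*-comm R′ p)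
                       (H p (suc t) p-prime (*-monoʳ-∣ p p^t∣fs)))
    ... | no  p≢f  = p^t∣m*n⇒p^t∣n p-prime t p∤f
                       (subst (p ^ t ∣_) (*-comm R′ f) (H p t p-prime (∣n⇒∣m*n f p^t∣fs)))
      where
      p∤f : ¬ p ∣ f
      p∤f = [ nonTrivial⇒≢1 {{prime⇒nonTrivial p-prime}} , p≢f ]′ ∘ prime⇒irreducible f-prime

x≤y⇒2xy≤x²+y² : ∀ {x y} → x ≤ y → 2 * (x * y) ≤ x * x + y * y
x≤y⇒2xy≤x²+y² {x} x≤y with m≤n⇒∃[o]m+o≡n x≤y
... | d , refl = subst (2 * (x * (x + d)) ≤_) (square x d) (m≤m+n _ (d * d))
  where square : ∀ x d → 2 * (x * (x + d)) + d * d ≡ x * x + (x + d) * (x + d)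
        square = solve-∀

2xy≤x²+y² : ∀ x y → 2 * (x * y) ≤ x * x + y * y
2xy≤x²+y² x y with ≤-total x y
... | inj₁ x≤y = x≤y⇒2xy≤x²+y² x≤y
... | inj₂ y≤x = subst₂ _≤_ (cong (2 *_) (*-comm y x)) (+-comm (y * y) (x * x)) (x≤y⇒2xy≤x²+y² y≤x)

mixedSum : ℕ → ℕ → ℕ → ℕ
mixedSum a b c = a * a * b + a * a * c + b * b * a + b * b * c + c * c * a + c * c * b

cubeSum : ℕ → ℕ → ℕ → ℕ
cubeSum a b c = a * a * a + b * b * b + c * c * c

6abc≤mixedSum : ∀ a b c → 6 * (a * (b * c)) ≤ mixedSum a b c
6abc≤mixedSum a b c = subst₂ _≤_ (lhs a b c) (rhs a b c)
  (+-mono-≤ (*-monoʳ-≤ c (2xy≤x²+y² a b))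
            (+-mono-≤ (*-monoʳ-≤ b (2xy≤x²+y² a c)) (*-monoʳ-≤ a (2xy≤x²+y² b c))))
  where
  lhs : ∀ a b c → c * (2 * (a * b)) + (b * (2 * (a * c)) + a * (2 * (b * c))) ≡ 6 * (a * (b * c))
  lhs = solve-∀
  rhs : ∀ a b c → c * (a * a + b * b) + (b * (a * a + c * c) + a * (b * b + c * c))
                  ≡ a * a * b + a * a * c + b * b * a + b * b * c + c * c * a + c * c * b
  rhs = solve-∀

mixedSum≤2cubeSum : ∀ a b c → mixedSum a b c ≤ 2 * cubeSum a b c
mixedSum≤2cubeSum a b c = +-cancelʳ-≤ (mixedSum a b c) (mixedSum a b c) (2 * cubeSum a b c)
  (subst₂ _≤_ (lhs a b c) (rhs a b c)
    (+-mono-≤ (*-monoʳ-≤ (a + b) (2xy≤x²+y² a b))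
              (+-mono-≤ (*-monoʳ-≤ (b + c) (2xy≤x²+y² b c)) (*-monoʳ-≤ (a + c) (2xy≤x²+y² a c)))))
  where
  lhs : ∀ a b c → (a + b) * (2 * (a * b)) + ((b + c) * (2 * (b * c)) + (a + c) * (2 * (a * c)))
                  ≡ (a * a * b + a * a * c + b * b * a + b * b * c + c * c * a + c * c * b)
                    + (a * a * b + a * a * c + b * b * a + b * b * c + c * c * a + c * c * b)
  lhs = solve-∀
  rhs : ∀ a b c → (a + b) * (a * a + b * b)
                    + ((b + c) * (b * b + c * c) + (a + c) * (a * a + c * c))
                  ≡ 2 * (a * a * a + b * b * b + c * c * c)
                    + (a * a * b + a * a * c + b * b * a + b * b * c + c * c * a + c * c * b)
  rhs = solve-∀

27abc≤[a+b+c]³ : ∀ a b c → 27 * (a * (b * c)) ≤ (a + b + c) * (a + b + c) * (a + b + c)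
27abc≤[a+b+c]³ a b c = begin
  27 * abc
    ≡⟨ split abc ⟩
  3 * abc + 3 * (6 * abc) + 6 * abc
    ≤⟨ +-monoˡ-≤ (6 * abc) (+-mono-≤ 3abc≤cubeSum (*-monoʳ-≤ 3 (6abc≤mixedSum a b c))) ⟩
  cubeSum a b c + 3 * mixedSum a b c + 6 * abc
    ≡⟨ expand a b c ⟩
  (a + b + c) * (a + b + c) * (a + b + c)  ∎
  where
  open ≤-Reasoning
  abc = a * (b * c)
  split : ∀ x → 27 * x ≡ 3 * x + 3 * (6 * x) + 6 * x
  split = solve-∀
  expand : ∀ a b c → a * a * a + b * b * b + c * c * c
                     + 3 * (a * a * b + a * a * c + b * b * a + b * b * c + c * c * a + c * c * b)
                     + 6 * (a * (b * c))
                     ≡ (a + b + c) * (a + b + c) * (a + b + c)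
  expand = solve-∀
  3abc≤cubeSum : 3 * abc ≤ cubeSum a b c
  3abc≤cubeSum = *-cancelˡ-≤ 2 (subst (_≤ 2 * cubeSum a b c) (*-assoc 2 3 abc)
                   (≤-trans (6abc≤mixedSum a b c) (mixedSum≤2cubeSum a b c)))

all<? : ∀ {P : ℕ → Set} → (∀ k → Dec (P k)) → ∀ n → Dec (∀ k → k < n → P k)
all<? P? zero = yes λ _ ()
all<? {P} P? (suc n) with all<? P? n | P? n
... | no ¬all | _      = no λ all → ¬all λ k k<n → all k (m<n⇒m<1+n k<n)
... | yes _   | no ¬pn = no λ all → ¬pn (all n ≤-refl)
... | yes all | yes pn = yes λ k k<1+n →
  [ all k , (λ k≡n → subst P (sym k≡n) pn) ]′ (m<1+n⇒m<n∨m≡n k<1+n)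

OneOf TwoOf : (ℕ → Set) → ℕ → ℕ → ℕ → Set
OneOf P x y z = P x ⊎ P y ⊎ P z
TwoOf P x y z = (P y × P z) ⊎ (P x × P z) ⊎ (P x × P y)

TwoOf-map : ∀ {P Q : ℕ → Set} {x y z} → (∀ {w} → P w → Q w) → TwoOf P x y z → TwoOf Q x y z
TwoOf-map f (inj₁ (py , pz))        = inj₁ (f py , f pz)
TwoOf-map f (inj₂ (inj₁ (px , pz))) = inj₂ (inj₁ (f px , f pz))
TwoOf-map f (inj₂ (inj₂ (px , py))) = inj₂ (inj₂ (f px , f py))

OneOf-map : ∀ {P Q : ℕ → Set} {x y z} → (∀ {w} → P w → Q w) → OneOf P x y z → OneOf Q x y z
OneOf-map f (inj₁ px)        = inj₁ (f px)
OneOf-map f (inj₂ (inj₁ py)) = inj₂ (inj₁ (f py))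
OneOf-map f (inj₂ (inj₂ pz)) = inj₂ (inj₂ (f pz))

TwoOf⇒OneOf : ∀ {P : ℕ → Set} {x y z} → TwoOf P x y z → OneOf P x y z
TwoOf⇒OneOf (inj₁ (py , _))        = inj₂ (inj₁ py)
TwoOf⇒OneOf (inj₂ (inj₁ (px , _))) = inj₁ px
TwoOf⇒OneOf (inj₂ (inj₂ (px , _))) = inj₁ px

sum≤2⇒oneZero : ∀ a b c → a + (b + c) ≤ 2 → OneOf (_≡ 0) a b c
sum≤2⇒oneZero zero    _       _       _ = inj₁ refl
sum≤2⇒oneZero (suc _) zero    _       _ = inj₂ (inj₁ refl)
sum≤2⇒oneZero (suc _) (suc _) zero    _ = inj₂ (inj₂ refl)
sum≤2⇒oneZero (suc a) (suc b) (suc c) h =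
  contradiction h (<⇒≱ (+-mono-≤ (s≤s z≤n) (+-mono-≤ (s≤s z≤n) (s≤s z≤n))))

sum≡0⇒allZero : ∀ {a b c} → a + (b + c) ≡ 0 → a ≡ 0 × b ≡ 0 × c ≡ 0
sum≡0⇒allZero {a} {b} e =
  m+n≡0⇒m≡0 a e , m+n≡0⇒m≡0 b (m+n≡0⇒n≡0 a e) , m+n≡0⇒n≡0 b (m+n≡0⇒n≡0 a e)

sum≡1⇒twoZero : ∀ a b c → a + (b + c) ≡ 1 → TwoOf (_≡ 0) a b c
sum≡1⇒twoZero zero    zero    _ _ = inj₂ (inj₂ (refl , refl))
sum≡1⇒twoZero zero    (suc b) c e = inj₂ (inj₁ (refl , m+n≡0⇒n≡0 b (suc-injective e)))
sum≡1⇒twoZero (suc a) b       c e = inj₁ (m+n≡0⇒m≡0 b b+c≡0 , m+n≡0⇒n≡0 b b+c≡0)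
  where b+c≡0 = m+n≡0⇒n≡0 a (suc-injective e)

sum≡d⇒twoZero : ∀ {d a b c} .{{_ : NonZero d}} → d ∣ a → d ∣ b → d ∣ c →
                a + (b + c) ≡ d → TwoOf (_≡ 0) a b c
sum≡d⇒twoZero {d} (divides a refl) (divides b refl) (divides c refl) e =
  TwoOf-map {Q = λ w → w * d ≡ 0} {a} {b} {c} (cong (_* d))
    (sum≡1⇒twoZero a b c (*-cancelʳ-≡ _ 1 d (begin
      (a + (b + c)) * d        ≡⟨ *-distribʳ-+ d a (b + c) ⟩
      a * d + (b + c) * d      ≡⟨ cong (a * d +_) (*-distribʳ-+ d b c) ⟩
      a * d + (b * d + c * d)  ≡⟨ e ⟩
      d                        ≡⟨ *-identityˡ d ⟨
      1 * d                    ∎)))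
  where open ≡-Reasoning

*-pres-∣₃ : ∀ {d₁ d₂ d₃ x y z} → d₁ ∣ x → d₂ ∣ y → d₃ ∣ z → d₁ * (d₂ * d₃) ∣ x * (y * z)
*-pres-∣₃ d₁∣x d₂∣y d₃∣z = *-pres-∣ d₁∣x (*-pres-∣ d₂∣y d₃∣z)

OneOf⇒∣product : ∀ {e d x y z} → OneOf (e ∣_) x y z → d ∣ x → d ∣ y → d ∣ z →
                 e * (d * d) ∣ x * (y * z)
OneOf⇒∣product {e} {d} {x} {y} {z} (inj₁ e∣x)        _   d∣y d∣z = *-pres-∣₃ e∣x d∣y d∣z
OneOf⇒∣product {e} {d} {x} {y} {z} (inj₂ (inj₁ e∣y)) d∣x _   d∣z =
  subst (_∣ x * (y * z)) (swap-front d e) (*-pres-∣₃ d∣x e∣y d∣z)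
  where swap-front : ∀ d e → d * (e * d) ≡ e * (d * d)
        swap-front = solve-∀
OneOf⇒∣product {e} {d} {x} {y} {z} (inj₂ (inj₂ e∣z)) d∣x d∣y _   =
  subst (_∣ x * (y * z)) (rotate d e) (*-pres-∣₃ d∣x d∣y e∣z)
  where rotate : ∀ d e → d * (d * e) ≡ e * (d * d)
        rotate = solve-∀

TwoOf⇒∣product : ∀ {e d x y z} → TwoOf (e ∣_) x y z → d ∣ x → d ∣ y → d ∣ z →
                 d * (e * e) ∣ x * (y * z)
TwoOf⇒∣product {e} {d} {x} {y} {z} (inj₁ (e∣y , e∣z))        d∣x _   _   = *-pres-∣₃ d∣x e∣y e∣z
TwoOf⇒∣product {e} {d} {x} {y} {z} (inj₂ (inj₁ (e∣x , e∣z))) _   d∣y _   =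
  subst (_∣ x * (y * z)) (swap-front e d) (*-pres-∣₃ e∣x d∣y e∣z)
  where swap-front : ∀ e d → e * (d * e) ≡ d * (e * e)
        swap-front = solve-∀
TwoOf⇒∣product {e} {d} {x} {y} {z} (inj₂ (inj₂ (e∣x , e∣y))) _   _   d∣z =
  subst (_∣ x * (y * z)) (rotate e d) (*-pres-∣₃ e∣x e∣y d∣z)
  where rotate : ∀ e d → e * (e * d) ≡ d * (e * e)
        rotate = solve-∀

module Kummer {p : ℕ} (p-prime : Prime p) where

  instance
    p≢0 : NonZero p
    p≢0 = prime⇒nonZero p-prime

  p>1 : 1 < p
  p>1 = nonTrivial⇒n>1 p {{prime⇒nonTrivial p-prime}}

  p∤1 : ¬ p ∣ 1
  p∤1 p∣1 = <⇒≢ p>1 (sym (∣1⇒≡1 p∣1))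

  coprimeFactorial : ℕ → ℕ
  coprimeFactorial zero    = 1
  coprimeFactorial (suc n) with p ∣? suc n
  ... | yes _ = coprimeFactorial n
  ... | no  _ = suc n * coprimeFactorial n

  p∤coprimeFactorial : ∀ n → ¬ p ∣ coprimeFactorial n
  p∤coprimeFactorial zero    = p∤1
  p∤coprimeFactorial (suc n) with p ∣? suc n
  ... | yes _   = p∤coprimeFactorial n
  ... | no  p∤n = [ p∤n , p∤coprimeFactorial n ]′ ∘ euclidsLemma (suc n) _ p-prime

  private
    suc-by-digits : ∀ n → suc n ≡ suc (n % p) + (n / p) * p
    suc-by-digits n = cong suc (m≡m%n+[m/n]*n n p)

  p∣1+n⇒[1+n]/p≡1+n/p : ∀ n → p ∣ suc n → suc n / p ≡ suc (n / p)
  p∣1+n⇒[1+n]/p≡1+n/p n p∣1+n with m≤n⇒m<n∨m≡n (m%n<n n p)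
  ... | inj₁ 1+r<p = contradiction p∣1+n λ p∣1+n → 0≢1+n (begin
    0                              ≡⟨ n∣m⇒m%n≡0 (suc n) p p∣1+n ⟨
    suc n % p                      ≡⟨ %-congˡ {o = p} (suc-by-digits n) ⟩
    (suc (n % p) + n / p * p) % p  ≡⟨ [r+q*d]%d≡r _ (n / p) 1+r<p ⟩
    suc (n % p)                    ∎)
    where open ≡-Reasoning
  ... | inj₂ 1+r≡p = begin
    suc n / p                      ≡⟨ /-congˡ {o = p} (suc-by-digits n) ⟩
    (suc (n % p) + n / p * p) / p  ≡⟨ /-congˡ {o = p} (cong (_+ n / p * p) 1+r≡p) ⟩
    (p + n / p * p) / p            ≡⟨ m*n/n≡m (suc (n / p)) p ⟩
    suc (n / p)                    ∎
    where open ≡-Reasoning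

  p∤1+n⇒[1+n]/p≡n/p : ∀ n → ¬ p ∣ suc n → suc n / p ≡ n / p
  p∤1+n⇒[1+n]/p≡n/p n p∤1+n with m≤n⇒m<n∨m≡n (m%n<n n p)
  ... | inj₁ 1+r<p = trans (/-congˡ {o = p} (suc-by-digits n)) ([r+q*d]/d≡q _ (n / p) 1+r<p)
  ... | inj₂ 1+r≡p = contradiction (divides (suc (n / p))
          (trans (suc-by-digits n) (cong (_+ n / p * p) 1+r≡p))) p∤1+n

  factorial-split : ∀ n → n ! ≡ coprimeFactorial n * (p ^ (n / p) * (n / p) !)
  factorial-split zero = sym (trans (*-identityˡ _) (cong (λ k → p ^ k * k !) (0/n≡0 p)))
  factorial-split (suc n) with p ∣? suc n
  ... | yes p∣1+n = begin
    suc n * n !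
      ≡⟨ cong₂ _*_ 1+n≡p*[1+k] (factorial-split n) ⟩
    p * suc k * (R * (p ^ k * k !))
      ≡⟨ regroup p k R (p ^ k) (k !) ⟩
    R * (p ^ suc k * suc k !)
      ≡⟨ cong (λ m → R * (p ^ m * m !)) (p∣1+n⇒[1+n]/p≡1+n/p n p∣1+n) ⟨
    R * (p ^ (suc n / p) * (suc n / p) !)  ∎
    where
    open ≡-Reasoning
    k = n / p
    R = coprimeFactorial n
    1+n≡p*[1+k] : suc n ≡ p * suc k
    1+n≡p*[1+k] = trans (sym (m*[n/m]≡n p∣1+n)) (cong (p *_) (p∣1+n⇒[1+n]/p≡1+n/p n p∣1+n))
    regroup : ∀ p k r a f → p * suc k * (r * (a * f)) ≡ r * (p * a * (suc k * f))
    regroup = solve-∀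
  ... | no p∤1+n = begin
    suc n * n !
      ≡⟨ cong (suc n *_) (factorial-split n) ⟩
    suc n * (R * (p ^ (n / p) * (n / p) !))
      ≡⟨ *-assoc (suc n) R _ ⟨
    suc n * R * (p ^ (n / p) * (n / p) !)
      ≡⟨ cong (λ m → suc n * R * (p ^ m * m !)) (p∤1+n⇒[1+n]/p≡n/p n p∤1+n) ⟨
    suc n * R * (p ^ (suc n / p) * (suc n / p) !)  ∎
    where
    open ≡-Reasoning
    R = coprimeFactorial n

  p∤coprimePart : ∀ cs → ¬ p ∣ product (map coprimeFactorial cs)
  p∤coprimePart []       = p∤1
  p∤coprimePart (c ∷ cs) = [ p∤coprimeFactorial c , p∤coprimePart cs ]′ ∘ euclidsLemma _ _ p-prime

  factProd-split : ∀ cs → factProd cs ≡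
    product (map coprimeFactorial cs) * (p ^ sum (map (_/ p) cs) * factProd (map (_/ p) cs))
  factProd-split []       = refl
  factProd-split (c ∷ cs) = begin
    c ! * factProd cs
      ≡⟨ cong₂ _*_ (factorial-split c) (factProd-split cs) ⟩
    coprimeFactorial c * (p ^ (c / p) * (c / p) !) * (R * (p ^ Y * F))
      ≡⟨ regroup (coprimeFactorial c) (p ^ (c / p)) ((c / p) !) R (p ^ Y) F ⟩
    coprimeFactorial c * R * (p ^ (c / p) * p ^ Y * ((c / p) ! * F))
      ≡⟨ cong (λ z → coprimeFactorial c * R * (z * ((c / p) ! * F)))
              (^-distribˡ-+-* p (c / p) Y) ⟨
    coprimeFactorial c * R * (p ^ (c / p + Y) * ((c / p) ! * F))  ∎
    where
    open ≡-Reasoning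
    R = product (map coprimeFactorial cs)
    Y = sum (map (_/ p) cs)
    F = factProd (map (_/ p) cs)
    regroup : ∀ r a f R A F → r * (a * f) * (R * (A * F)) ≡ r * R * (a * A * (f * F))
    regroup = solve-∀

  sum-split : ∀ cs → sum cs ≡ sum (map (_% p) cs) + sum (map (_/ p) cs) * p
  sum-split []       = refl
  sum-split (c ∷ cs) =
    trans (cong₂ _+_ (m≡m%n+[m/n]*n c p) (sum-split cs)) (regroup (c % p) (c / p) _ _ p)
    where
    regroup : ∀ r q s t p → r + q * p + (s + t * p) ≡ r + s + (q + t) * p
    regroup = solve-∀

  -- M, A, B stand for the multinomial, the p-free part of ∏ cᵢ! and that of N!; c is the carry
  -- out of the last base-p digit, so comparing powers of p forces it to vanish.
  noCarry-step : ∀ {M A B M′ F Y c} .{{_ : NonZero F}} → ¬ p ∣ M → ¬ p ∣ A → M′ * F ≡ Y ! →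
                 M * (A * (p ^ Y * F)) ≡ B * (p ^ (c + Y) * (c + Y) !) → c ≡ 0 × ¬ p ∣ M′
  noCarry-step {M} {A} {B} {M′} {F} {Y} {c} p∤M p∤A M′*F≡Y! eq
    with m≤n⇒m!∣n! (m≤n+m Y c)
  ... | divides E [c+Y]!≡E*Y! =
    no-carry MA≡ , λ p∣M′ → p∤MA (subst (p ∣_) (sym MA≡) (∣n⇒∣m*n (B * p ^ c * E) p∣M′))
    where
    instance _ = m*n≢0 (p ^ Y) F {{m^n≢0 p Y}}
    p∤MA : ¬ p ∣ M * A
    p∤MA = [ p∤M , p∤A ]′ ∘ euclidsLemma M A p-prime
    regroup : ∀ B a b E M F → B * (a * b * (E * (M * F))) ≡ B * a * E * M * (b * F)
    regroup = solve-∀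
    MA≡ : M * A ≡ B * p ^ c * E * M′
    MA≡ = *-cancelʳ-≡ (M * A) (B * p ^ c * E * M′) (p ^ Y * F) (begin
      M * A * (p ^ Y * F)                   ≡⟨ *-assoc M A _ ⟩
      M * (A * (p ^ Y * F))                 ≡⟨ eq ⟩
      B * (p ^ (c + Y) * (c + Y) !)         ≡⟨ cong₂ (λ u v → B * (u * v)) (^-distribˡ-+-* p c Y)
                                                 (trans [c+Y]!≡E*Y! (cong (E *_) (sym M′*F≡Y!))) ⟩
      B * (p ^ c * p ^ Y * (E * (M′ * F)))  ≡⟨ regroup B (p ^ c) (p ^ Y) E M′ F ⟩
      B * p ^ c * E * M′ * (p ^ Y * F)      ∎)
      where open ≡-Reasoning
    no-carry : ∀ {k} → M * A ≡ B * p ^ k * E * M′ → k ≡ 0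
    no-carry {zero}  _    = refl
    no-carry {suc k} MA≡′ = contradiction (subst (p ∣_) (sym MA≡′)
          (∣m⇒∣m*n M′ (∣m⇒∣m*n E (∣n⇒∣m*n B (∣m⇒∣m*n (p ^ k) ∣-refl))))) p∤MA

  acceptable⇒lastDigit : ∀ cs → pAcceptable p cs →
                         sum (map (_% p) cs) < p × pAcceptable p (map (_/ p) cs)
  acceptable⇒lastDigit cs p∤M = m/n≡0⇒m<n (proj₁ step) , proj₂ step
    where
    open ≡-Reasoning
    S = sum (map (_% p) cs)
    ys = map (_/ p) cs
    Y = sum ys
    N = sum cs
    N≡ : N ≡ S % p + (S / p + Y) * p
    N≡ = trans (sum-split cs)
               (trans (cong (_+ Y * p) (m≡m%n+[m/n]*n S p)) (regroup (S % p) (S / p) Y p))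
      where
      regroup : ∀ r c Y p → r + c * p + Y * p ≡ r + (c + Y) * p
      regroup = solve-∀
    N/p≡ : N / p ≡ S / p + Y
    N/p≡ = trans (/-congˡ {o = p} N≡) ([r+q*d]/d≡q (S % p) (S / p + Y) (m%n<n S p))
    eq : multinomial cs * (product (map coprimeFactorial cs) * (p ^ Y * factProd ys))
         ≡ coprimeFactorial N * (p ^ (S / p + Y) * (S / p + Y) !)
    eq = begin
      multinomial cs * (product (map coprimeFactorial cs) * (p ^ Y * factProd ys))
        ≡⟨ cong (multinomial cs *_) (factProd-split cs) ⟨
      multinomial cs * factProd cs  ≡⟨ multinomial*factProd≡sum! cs ⟩
      N !                           ≡⟨ factorial-split N ⟩
      coprimeFactorial N * (p ^ (N / p) * (N / p) !)
        ≡⟨ cong (λ k → coprimeFactorial N * (p ^ k * k !)) N/p≡ ⟩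
      coprimeFactorial N * (p ^ (S / p + Y) * (S / p + Y) !)  ∎
    step = noCarry-step {B = coprimeFactorial N} {Y = Y} {{factProd≢0 ys}}
             p∤M (p∤coprimePart cs) (multinomial*factProd≡sum! ys) eq

  residue : ℕ → ℕ → ℕ
  residue t x = (x % p ^ t) {{m^n≢0 p t}}

  residue-suc : ∀ t x → residue (suc t) x ≡ x % p + p * residue t (x / p)
  residue-suc t x = trans (%-congˡ {o = p ^ suc t} x≡) ([r+q*d]%d≡r r k r<p^[1+t])
    where
    instance _ = m^n≢0 p t
    instance _ = m^n≢0 p (suc t)
    r = x % p + p * residue t (x / p)
    k = x / p / p ^ t
    regroup : ∀ a b k p q → a + (b + k * q) * p ≡ a + p * b + k * (p * q)
    regroup = solve-∀
    x≡ : x ≡ r + k * p ^ suc t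
    x≡ = trans (m≡m%n+[m/n]*n x p)
               (trans (cong (λ y → x % p + y * p) (m≡m%n+[m/n]*n (x / p) (p ^ t)))
                      (regroup (x % p) (residue t (x / p)) k p (p ^ t)))
    r<p^[1+t] : r < p ^ suc t
    r<p^[1+t] = r+d*s<d*e (m%n<n x p) (m%n<n (x / p) (p ^ t))

  sum-residue-zero : ∀ cs → sum (map (residue 0) cs) ≡ 0
  sum-residue-zero []       = refl
  sum-residue-zero (c ∷ cs) = cong₂ _+_ (n%1≡0 c) (sum-residue-zero cs)

  acceptable⇒residuesAdd : ∀ t cs → pAcceptable p cs →
                           sum (map (residue t) cs) ≡ residue t (sum cs)
  acceptable⇒residuesAdd zero    cs _   = trans (sum-residue-zero cs) (sym (n%1≡0 (sum cs)))
  acceptable⇒residuesAdd (suc t) cs acc = begin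
    sum (map (residue (suc t)) cs)
      ≡⟨ cong sum (map-cong (residue-suc t) cs) ⟩
    sum (map (λ x → x % p + p * residue t (x / p)) cs)
      ≡⟨ sum-map-linear (_% p) (residue t ∘ (_/ p)) p cs ⟩
    S + p * sum (map (residue t ∘ (_/ p)) cs)
      ≡⟨ cong (λ zs → S + p * sum zs) (map-∘ cs) ⟩
    S + p * sum (map (residue t) (map (_/ p) cs))
      ≡⟨ cong (λ z → S + p * z) (acceptable⇒residuesAdd t (map (_/ p) cs) (proj₂ lastDigit)) ⟩
    S + p * residue t Y
      ≡⟨ cong₂ (λ a b → a + p * residue t b) S≡N%p Y≡N/p ⟩
    N % p + p * residue t (N / p)
      ≡⟨ residue-suc t N ⟨
    residue (suc t) N  ∎
    where
    open ≡-Reasoning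
    S = sum (map (_% p) cs)
    Y = sum (map (_/ p) cs)
    N = sum cs
    lastDigit = acceptable⇒lastDigit cs acc
    S≡N%p : S ≡ N % p
    S≡N%p = sym (trans (%-congˡ {o = p} (sum-split cs)) ([r+q*d]%d≡r S Y (proj₁ lastDigit)))
    Y≡N/p : Y ≡ N / p
    Y≡N/p = sym (trans (/-congˡ {o = p} (sum-split cs)) ([r+q*d]/d≡q S Y (proj₁ lastDigit)))

-- The clauses are what the five non-trivial situations below (p ∣ N, p ∣ N ∸ 1, p ∣ N ∸ 2, and
-- p = 2 dividing both N and N ∸ 2 in the two possible ways) demand of E, for q = pᵉ, when the
-- decomposition N = (N ∸ i ∸ j) + i + j has no carries in base p.
TableBound : ℕ → ℕ → ℕ → (q : ℕ) → .{{_ : NonZero q}} → Set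
TableBound i j E q =
  (¬ 2 ∣ q → i % q + j % q ≡ 0 → q * (q * q) ∣ E) ×
  (i % q + j % q ≤ 1 → q * q ∣ E) ×
  (¬ 2 ∣ q → i % q + j % q ≤ 2 → q ∣ E) ×
  (4 ∣ q → 2 ∣ i → 2 ∣ j → i % q + j % q ≤ 2 → 8 * q ∣ E) ×
  (4 ∣ q → i % q + j % q ≡ 0 → 2 * (q * (q * q)) ∣ E)

TableBound? : ∀ i j E q .{{_ : NonZero q}} → Dec (TableBound i j E q)
TableBound? i j E q =
  (¬? (2 ∣? q) →-dec i % q + j % q ≟ 0 →-dec q * (q * q) ∣? E) ×-dec
  (i % q + j % q ≤? 1 →-dec q * q ∣? E) ×-dec
  (¬? (2 ∣? q) →-dec i % q + j % q ≤? 2 →-dec q ∣? E) ×-dec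
  (4 ∣? q →-dec 2 ∣? i →-dec 2 ∣? j →-dec i % q + j % q ≤? 2 →-dec 8 * q ∣? E) ×-dec
  (4 ∣? q →-dec i % q + j % q ≟ 0 →-dec 2 * (q * (q * q)) ∣? E)

InRange : ℕ → ℕ → Set
InRange i j = 1 ≤ i × 1 ≤ j × 3 ≤ i + j × i + j ≤ 10

InRange? : ∀ i j → Dec (InRange i j)
InRange? i j = 1 ≤? i ×-dec 1 ≤? j ×-dec 3 ≤? i + j ×-dec i + j ≤? 10

InRange⇒<10 : ∀ {i j} → InRange i j → i < 10 × j < 10
InRange⇒<10 {i} {j} (1≤i , 1≤j , _ , i+j≤10) =
  ≤-trans (subst (_≤ i + j) (+-comm i 1) (+-monoʳ-≤ i 1≤j)) i+j≤10 ,
  ≤-trans (+-monoˡ-≤ j 1≤i) i+j≤10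

-- table i j is the least E such that TableBound i j E q holds for every q > 1.
table : ℕ → ℕ → ℕ
table 1 2 = 4
table 1 3 = 9
table 1 4 = 48
table 1 5 = 25
table 1 6 = 180
table 1 7 = 147
table 1 8 = 448
table 1 9 = 81
table 2 1 = 4
table 2 2 = 4
table 2 3 = 12
table 2 4 = 32
table 2 5 = 20
table 2 6 = 12
table 2 7 = 28
table 2 8 = 64
table 3 1 = 9
table 3 2 = 12
table 3 3 = 27
table 3 4 = 36
table 3 5 = 3
table 3 6 = 108
table 3 7 = 9
table 4 1 = 48
table 4 2 = 32
table 4 3 = 36
table 4 4 = 384
table 4 5 = 16
table 4 6 = 288
table 5 1 = 25
table 5 2 = 20
table 5 3 = 3
table 5 4 = 16
table 5 5 = 125
table 6 1 = 180
table 6 2 = 12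
table 6 3 = 108
table 6 4 = 288
table 7 1 = 147
table 7 2 = 28
table 7 3 = 9
table 8 1 = 448
table 8 2 = 64
table 9 1 = 81
table _ _ = 1

tableBound-decided : ∀ i → i < 10 → ∀ j → j < 10 → InRange i j →
                     ∀ k → k < 8 → TableBound i j (table i j) (2 + k)
tableBound-decided = toWitness {a? = all<? (λ i → all<? (λ j → InRange? i j →-dec
                       all<? (λ k → TableBound? i j (table i j) (2 + k)) 8) 10) 10} _

tableBound : ∀ {i j} → InRange i j → ∀ q .{{_ : NonZero q}} → 1 < q → TableBound i j (table i j) q
tableBound {i} {j} range q 1<q with q ≤? 9
... | yes q≤9 = reindex (sym (m+[n∸m]≡n 1<q))
                  (tableBound-decided i i<10 j j<10 range (q ∸ 2) (s≤s (∸-monoˡ-≤ 2 q≤9)))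
  where
  i<10 = proj₁ (InRange⇒<10 range)
  j<10 = proj₂ (InRange⇒<10 range)
  reindex : ∀ {q k} .{{_ : NonZero q}} → q ≡ 2 + k →
            TableBound i j (table i j) (2 + k) → TableBound i j (table i j) q
  reindex refl tb = tb
... | no q≰9 =
  (λ _ s≡0 → ⊥-elim (too-large z≤n (≤-reflexive s≡0))) ,
  (λ s≤1 → ⊥-elim (too-large (s≤s z≤n) s≤1)) ,
  (λ _ s≤2 → ⊥-elim (too-large ≤-refl s≤2)) ,
  (λ _ _ _ s≤2 → ⊥-elim (too-large ≤-refl s≤2)) ,
  (λ _ s≡0 → ⊥-elim (too-large z≤n (≤-reflexive s≡0)))
  where
  9<q = ≰⇒> q≰9
  i%q+j%q≡i+j : i % q + j % q ≡ i + j
  i%q+j%q≡i+j = cong₂ _+_ (m<n⇒m%n≡m (<-≤-trans (proj₁ (InRange⇒<10 range)) 9<q))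
                          (m<n⇒m%n≡m (<-≤-trans (proj₂ (InRange⇒<10 range)) 9<q))
  too-large : ∀ {r} → r ≤ 2 → ¬ i % q + j % q ≤ r
  too-large r≤2 s≤r = <⇒≱ (≤-trans (proj₁ (proj₂ (proj₂ range))) (≤-reflexive (sym i%q+j%q≡i+j)))
                          (≤-trans s≤r r≤2)

-- Coefficientwise in k, the four clauses give E(m + k + 2)³ < 729(m + k + 1)²(m + k) for all k.
SizeBound : ℕ → ℕ → Set
SizeBound m E =
  E * ((m + 2) * (m + 2) * (m + 2)) < 729 * ((m + 1) * (m + 1) * m) ×
  E * (3 * ((m + 2) * (m + 2))) ≤ 729 * ((m + 1) * (m + 1) + 2 * (m + 1) * m) ×
  E * (3 * (m + 2)) ≤ 729 * (3 * m + 2) ×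
  E ≤ 729

SizeBound? : ∀ m E → Dec (SizeBound m E)
SizeBound? m E =
  E * ((m + 2) * (m + 2) * (m + 2)) <? 729 * ((m + 1) * (m + 1) * m) ×-dec
  E * (3 * ((m + 2) * (m + 2))) ≤? 729 * ((m + 1) * (m + 1) + 2 * (m + 1) * m) ×-dec
  E * (3 * (m + 2)) ≤? 729 * (3 * m + 2) ×-dec
  E ≤? 729

sizeBound⇒inequality : ∀ {m E} → SizeBound m E → ∀ k →
  E * ((m + k + 2) * (m + k + 2) * (m + k + 2)) < 729 * ((m + k + 1) * (m + k + 1) * (m + k))
sizeBound⇒inequality {m} {E} (c₀ , c₁ , c₂ , c₃) k =
  subst₂ _<_ (sym (lhs m E k)) (sym (rhs m k))
    (+-mono-<-≤ c₀ (+-mono-≤ (*-monoˡ-≤ k c₁)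
                             (+-mono-≤ (*-monoˡ-≤ (k * k) c₂) (*-monoˡ-≤ (k * k * k) c₃))))
  where
  lhs : ∀ m E k → E * ((m + k + 2) * (m + k + 2) * (m + k + 2)) ≡
        E * ((m + 2) * (m + 2) * (m + 2)) + (E * (3 * ((m + 2) * (m + 2))) * k
          + (E * (3 * (m + 2)) * (k * k) + E * (k * k * k)))
  lhs = solve-∀
  rhs : ∀ m k → 729 * ((m + k + 1) * (m + k + 1) * (m + k)) ≡
        729 * ((m + 1) * (m + 1) * m) + (729 * ((m + 1) * (m + 1) + 2 * (m + 1) * m) * k
          + (729 * (3 * m + 2) * (k * k) + 729 * (k * k * k)))
  rhs = solve-∀

tableSize-decided : ∀ i → i < 10 → ∀ j → j < 10 → InRange i j →
                    0 < table i j × SizeBound (i + j ∸ 1) (table i j)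
tableSize-decided = toWitness {a? = all<? (λ i → all<? (λ j → InRange? i j →-dec
                      (0 <? table i j ×-dec SizeBound? (i + j ∸ 1) (table i j))) 10) 10} _

tableSize : ∀ {i j} → InRange i j → 0 < table i j × SizeBound (i + j ∸ 1) (table i j)
tableSize range =
  tableSize-decided _ (proj₁ (InRange⇒<10 range)) _ (proj₂ (InRange⇒<10 range)) range

weight : ℕ → ℕ
weight N = N * N * N * (N ∸ 1) * (N ∸ 1) * (N ∸ 2)

module Situations {p : ℕ} (p-prime : Prime p) where
  open Kummer p-prime

  1<p^e : ∀ e → 0 < e → 1 < p ^ e
  1<p^e e = ^-monoʳ-< p p>1

  p^[e+e] : ∀ e → p ^ (e + e) ≡ p ^ e * p ^ e
  p^[e+e] e = ^-distribˡ-+-* p e e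

  p^[e+[e+e]] : ∀ e → p ^ (e + (e + e)) ≡ p ^ e * (p ^ e * p ^ e)
  p^[e+[e+e]] e = trans (^-distribˡ-+-* p e (e + e)) (cong (p ^ e *_) (p^[e+e] e))

  4∣p^e : p ≡ 2 → ∀ {e} → 1 < e → 4 ∣ p ^ e
  4∣p^e p≡2 {suc (suc e)} (s≤s (s≤s _)) =
    subst (λ b → 4 ∣ b ^ suc (suc e)) (sym p≡2) (divides (2 ^ e) (regroup (2 ^ e)))
    where regroup : ∀ q → 2 * (2 * q) ≡ q * 4
          regroup = solve-∀

  2∣p^e⇒p≡2 : ∀ e → 2 ∣ p ^ e → p ≡ 2
  2∣p^e⇒p≡2 zero    2∣1 = contradiction (∣1⇒≡1 2∣1) λ ()
  2∣p^e⇒p≡2 (suc e) 2∣p^[1+e] with euclidsLemma p (p ^ e) prime[2] 2∣p^[1+e]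
  ... | inj₂ 2∣p^e = 2∣p^e⇒p≡2 e 2∣p^e
  ... | inj₁ 2∣p  with prime⇒irreducible p-prime 2∣p
  ...   | inj₂ 2≡p = sym 2≡p

  p∤* : ∀ {a b} → ¬ p ∣ a → ¬ p ∣ b → ¬ p ∣ a * b
  p∤* p∤a p∤b = [ p∤a , p∤b ]′ ∘ euclidsLemma _ _ p-prime

  p∤consecutive : ∀ {m} → p ∣ suc m → p ∣ m → ⊥
  p∤consecutive {m} p∣1+m p∣m = p∤1 (∣m+n∣m⇒∣n (subst (p ∣_) (+-comm 1 m) p∣1+m) p∣m)

  p∣gap2⇒p≡2 : ∀ {m} → p ∣ 2 + m → p ∣ m → p ≡ 2
  p∣gap2⇒p≡2 {m} p∣2+m p∣m =
    ≤-antisym (∣⇒≤ (∣m+n∣m⇒∣n (subst (p ∣_) (+-comm 2 m) p∣2+m) p∣m)) p>1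

  extractPowerOfP : ∀ n → 0 < n → ∃₂ λ e u → n ≡ p ^ e * u × ¬ p ∣ u
  extractPowerOfP = <-rec _ extract
    where
    extract : ∀ n → (∀ {m} → m < n → 0 < m → ∃₂ λ e u → m ≡ p ^ e * u × ¬ p ∣ u) →
              0 < n → ∃₂ λ e u → n ≡ p ^ e * u × ¬ p ∣ u
    extract n rec 0<n with p ∣? n
    ... | no  p∤n = 0 , n , sym (*-identityˡ n) , p∤n
    ... | yes (divides m refl) with rec m<m*p 0<m
      where
      0<m : 0 < m
      0<m = n≢0⇒n>0 λ { refl → <⇒≢ 0<n refl }
      m<m*p : m < m * p
      m<m*p = m<m*n m p {{>-nonZero 0<m}} p>1
    ... | e , u , m≡p^e*u , p∤u =
      suc e , u , trans (cong (_* p) m≡p^e*u) (regroup (p ^ e) u p) , p∤u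
      where regroup : ∀ a u p → a * u * p ≡ p * a * u
            regroup = solve-∀

  ≡p^[1+e]*u⇒p∣ : ∀ e {m u} → m ≡ p ^ suc e * u → p ∣ m
  ≡p^[1+e]*u⇒p∣ e {m} {u} m≡ = divides (p ^ e * u) (trans m≡ (regroup p (p ^ e) u))
    where regroup : ∀ p a u → p * a * u ≡ a * u * p
          regroup = solve-∀

  ≡p^0*u⇒p∤ : ∀ {m u} → m ≡ p ^ 0 * u → ¬ p ∣ u → ¬ p ∣ m
  ≡p^0*u⇒p∤ {m} {u} m≡ p∤u = p∤u ∘ subst (p ∣_) (trans m≡ (*-identityˡ u))

  residue-offset : ∀ e {m u} r → r < p ^ e → m ≡ p ^ e * u → residue e (r + m) ≡ r
  residue-offset e {m} {u} r r<p^e m≡ =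
    trans (%-congˡ {o = p ^ e} (cong (r +_) (trans m≡ (*-comm (p ^ e) u)))) ([r+q*d]%d≡r r u r<p^e)
    where instance _ = m^n≢0 p e

  -- Indexed by the exponent of p in N³(N ∸ 1)²(N ∸ 2); the last two cases are p = 2 with
  -- 2 ∥ N (and 4 ∣ N ∸ 2) or 2 ∥ N ∸ 2 (and 4 ∣ N).
  data Situation (N : ℕ) : ℕ → Set where
    coprime : Situation N 0
    p∣N     : ∀ e → 1 < p ^ e → ¬ 2 ∣ p ^ e → residue e N ≡ 0 → Situation N (e + (e + e))
    p∣N-1   : ∀ e → 1 < p ^ e → residue e N ≡ 1 → Situation N (e + e)
    p∣N-2   : ∀ e → 1 < p ^ e → ¬ 2 ∣ p ^ e → residue e N ≡ 2 → Situation N e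
    2∥N     : ∀ e → p ≡ 2 → 1 < e → residue 1 N ≡ 0 → residue e N ≡ 2 → Situation N (3 + e)
    2∥N-2   : ∀ e → p ≡ 2 → 1 < e → residue e N ≡ 0 → residue (suc e) N ≡ p ^ e →
              Situation N (suc (e + (e + e)))

  classify-2∥N-2 : ∀ {n a u₀} → p ≡ 2 → 3 + n ≡ p ^ suc (suc a) * u₀ → ¬ p ∣ u₀ →
                   Situation (3 + n) (suc (suc a) + (suc (suc a) + suc (suc a)) + 0 + 1)
  classify-2∥N-2 {n} {a} {u₀} p≡2 h₀ p∤u₀ =
    subst (Situation (3 + n)) (exponent e)
      (2∥N-2 e p≡2 (s≤s (s≤s z≤n)) (residue-offset e 0 (m^n>0 p e) h₀)
        (subst (λ m → residue (suc e) m ≡ p ^ e) (sym 3+n≡)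
          (residue-offset (suc e) (p ^ e) (^-monoʳ-< p p>1 (n<1+n e)) refl)))
    where
    open ≡-Reasoning
    e = suc (suc a)
    exponent : ∀ e → suc (e + (e + e)) ≡ e + (e + e) + 0 + 1
    exponent = solve-∀
    regroup : ∀ a k → a * suc (k * 2) ≡ a + 2 * a * k
    regroup = solve-∀
    u₀-odd = odd⇒1+2k (p∤u₀ ∘ subst (_∣ u₀) (sym p≡2))
    k = proj₁ u₀-odd
    3+n≡ : 3 + n ≡ p ^ e + p ^ suc e * k
    3+n≡ = begin
      3 + n                  ≡⟨ h₀ ⟩
      p ^ e * u₀             ≡⟨ cong (p ^ e *_) (proj₂ u₀-odd) ⟩
      p ^ e * suc (k * 2)    ≡⟨ regroup (p ^ e) k ⟩
      p ^ e + 2 * p ^ e * k  ≡⟨ cong (λ b → p ^ e + b * p ^ e * k) (sym p≡2) ⟩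
      p ^ e + p ^ suc e * k  ∎

  classify-even : ∀ {n a c u₀ u₂} → p ≡ 2 →
    3 + n ≡ p ^ suc a * u₀ → ¬ p ∣ u₀ → 1 + n ≡ p ^ suc c * u₂ → ¬ p ∣ u₂ →
    Situation (3 + n) (suc a + (suc a + suc a) + 0 + suc c)
  classify-even {n} {suc a} {suc c} p≡2 h₀ _ h₂ _ =
    ⊥-elim (<⇒≱ (*-mono-≤ p>1 p>1) (m≤n⇒m≤1+n p*p≤2))
    where
    p*p∣ : ∀ e {m u} → m ≡ p ^ suc (suc e) * u → p * p ∣ m
    p*p∣ e {u = u} m≡ = divides (p ^ e * u) (trans m≡ (regroup p (p ^ e) u))
      where regroup : ∀ p a u → p * (p * a) * u ≡ a * u * (p * p)
            regroup = solve-∀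
    p*p≤2 : p * p ≤ 2
    p*p≤2 = ∣⇒≤ (∣m+n∣m⇒∣n (subst (p * p ∣_) (+-comm 2 (1 + n)) (p*p∣ a h₀)) (p*p∣ c h₂))
  classify-even {n} {zero} {suc c} p≡2 h₀ _ h₂ _ =
    2∥N (suc (suc c)) p≡2 (s≤s (s≤s z≤n)) (residue-offset 1 0 (m^n>0 p 1) h₀)
        (residue-offset (suc (suc c)) 2 2<p^e h₂)
    where
    2<p^e : 2 < p ^ suc (suc c)
    2<p^e = ≤-trans (n≤1+n 3) (*-mono-≤ p>1 (1<p^e (suc c) (s≤s z≤n)))
  classify-even {a = suc a} {zero} p≡2 h₀ p∤u₀ _ _ = classify-2∥N-2 p≡2 h₀ p∤u₀
  classify-even {n} {zero} {zero} {u₀} {u₂} p≡2 h₀ p∤u₀ h₂ p∤u₂ with 2∣n⊎2∣1+n u₂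
  ... | inj₁ 2∣u₂   = contradiction (subst (_∣ u₂) (sym p≡2) 2∣u₂) p∤u₂
  ... | inj₂ 2∣1+u₂ =
    contradiction (subst (_∣ u₀) (sym p≡2) (subst (2 ∣_) (sym u₀≡1+u₂) 2∣1+u₂)) p∤u₀
    where
    double : ∀ {m u} → m ≡ p ^ 1 * u → m ≡ 2 * u
    double {u = u} m≡ = trans m≡ (cong (_* u) (trans (*-identityʳ p) p≡2))
    regroup : ∀ u → 2 + 2 * u ≡ 2 * suc u
    regroup = solve-∀
    u₀≡1+u₂ : u₀ ≡ suc u₂
    u₀≡1+u₂ = *-cancelˡ-≡ u₀ (suc u₂) 2
                (trans (sym (double h₀)) (trans (cong (2 +_) (double h₂)) (regroup u₂)))

  classify : ∀ {n e₀ e₁ e₂ u₀ u₁ u₂} →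
             3 + n ≡ p ^ e₀ * u₀ → ¬ p ∣ u₀ → 2 + n ≡ p ^ e₁ * u₁ → ¬ p ∣ u₁ →
             1 + n ≡ p ^ e₂ * u₂ → ¬ p ∣ u₂ → Situation (3 + n) (e₀ + (e₀ + e₀) + (e₁ + e₁) + e₂)
  classify {e₀ = suc a} {suc b} h₀ _ h₁ _ _  _ =
    ⊥-elim (p∤consecutive (≡p^[1+e]*u⇒p∣ a h₀) (≡p^[1+e]*u⇒p∣ b h₁))
  classify {e₁ = suc b} {suc c} _  _ h₁ _ h₂ _ =
    ⊥-elim (p∤consecutive (≡p^[1+e]*u⇒p∣ b h₁) (≡p^[1+e]*u⇒p∣ c h₂))
  classify {e₀ = zero} {zero} {zero} _ _ _ _ _ _ = coprime
  classify {n} {zero} {suc b} {zero} _ _ h₁ _ _ _ =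
    subst (Situation (3 + n)) (sym (+-identityʳ _))
      (p∣N-1 (suc b) 1<p^[1+b] (residue-offset (suc b) 1 1<p^[1+b] h₁))
    where 1<p^[1+b] = 1<p^e (suc b) (s≤s z≤n)
  classify {n} {suc a} {zero} {zero} h₀ _ _ _ h₂ p∤u₂ =
    subst (Situation (3 + n)) (exponent (suc a))
      (p∣N (suc a) (1<p^e (suc a) (s≤s z≤n)) p^e-odd
           (residue-offset (suc a) 0 (m^n>0 p (suc a)) h₀))
    where
    exponent : ∀ e → e + (e + e) ≡ e + (e + e) + 0 + 0
    exponent = solve-∀
    p^e-odd : ¬ 2 ∣ p ^ suc a
    p^e-odd 2∣p^e = ≡p^0*u⇒p∤ h₂ p∤u₂ (∣m+n∣m⇒∣n (≡p^[1+e]*u⇒p∣ a h₀)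
                      (subst (_∣ 2) (sym (2∣p^e⇒p≡2 (suc a) 2∣p^e)) ∣-refl))
  classify {n} {zero} {zero} {suc c} h₀ p∤u₀ _ _ h₂ _ =
    p∣N-2 (suc c) (1<p^e (suc c) (s≤s z≤n)) (p≢2 ∘ 2∣p^e⇒p≡2 (suc c))
      (residue-offset (suc c) 2 2<p^e h₂)
    where
    p≢2 : p ≢ 2
    p≢2 p≡2 = ≡p^0*u⇒p∤ h₀ p∤u₀ (∣m∣n⇒∣m+n (subst (_∣ 2) (sym p≡2) ∣-refl) (≡p^[1+e]*u⇒p∣ c h₂))
    2<p^e : 2 < p ^ suc c
    2<p^e = <-≤-trans (≤∧≢⇒< p>1 (p≢2 ∘ sym)) (m≤m*n p (p ^ c) {{m^n≢0 p c}})
  classify {n} {suc a} {zero} {suc c} h₀ p∤u₀ _ _ h₂ p∤u₂ =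
    classify-even (p∣gap2⇒p≡2 (≡p^[1+e]*u⇒p∣ a h₀) (≡p^[1+e]*u⇒p∣ c h₂)) h₀ p∤u₀ h₂ p∤u₂

  weight-split : ∀ n → ∃₂ λ C U → weight (3 + n) ≡ p ^ C * U × ¬ p ∣ U × Situation (3 + n) C
  weight-split n
    with extractPowerOfP (3 + n) (s≤s z≤n) | extractPowerOfP (2 + n) (s≤s z≤n)
       | extractPowerOfP (1 + n) (s≤s z≤n)
  ... | e₀ , u₀ , h₀ , p∤u₀ | e₁ , u₁ , h₁ , p∤u₁ | e₂ , u₂ , h₂ , p∤u₂ =
    _ , U , weight≡ , p∤U , classify {e₀ = e₀} {e₁} {e₂} h₀ p∤u₀ h₁ p∤u₁ h₂ p∤u₂
    where
    open ≡-Reasoning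
    a = p ^ e₀
    b = p ^ e₁
    c = p ^ e₂
    C = e₀ + (e₀ + e₀) + (e₁ + e₁) + e₂
    U = u₀ * u₀ * u₀ * u₁ * u₁ * u₂
    p∤U : ¬ p ∣ U
    p∤U = p∤* (p∤* (p∤* (p∤* (p∤* p∤u₀ p∤u₀) p∤u₀) p∤u₁) p∤u₁) p∤u₂
    f : ℕ → ℕ → ℕ → ℕ
    f x y z = x * x * x * y * y * z
    regroup : ∀ a b c u v w →
              a * u * (a * u) * (a * u) * (b * v) * (b * v) * (c * w)
              ≡ a * (a * a) * (b * b) * c * (u * u * u * v * v * w)
    regroup = solve-∀
    p^C≡ : p ^ C ≡ a * (a * a) * (b * b) * c
    p^C≡ = trans (^-distribˡ-+-* p (e₀ + (e₀ + e₀) + (e₁ + e₁)) e₂) (cong (_* c)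
             (trans (^-distribˡ-+-* p (e₀ + (e₀ + e₀)) (e₁ + e₁))
                    (cong₂ _*_ (p^[e+[e+e]] e₀) (p^[e+e] e₁))))
    weight≡ : weight (3 + n) ≡ p ^ C * U
    weight≡ = begin
      f (3 + n) (2 + n) (1 + n)      ≡⟨ cong₂ (λ x y → f x y (1 + n)) h₀ h₁ ⟩
      f (a * u₀) (b * u₁) (1 + n)    ≡⟨ cong (f (a * u₀) (b * u₁)) h₂ ⟩
      f (a * u₀) (b * u₁) (c * u₂)   ≡⟨ regroup a b c u₀ u₁ u₂ ⟩
      a * (a * a) * (b * b) * c * U  ≡⟨ cong (_* U) p^C≡ ⟨
      p ^ C * U                      ∎

  ResiduesAdd : ℕ → ℕ → ℕ → ℕ → Set
  ResiduesAdd N x y z = ∀ t → residue t x + (residue t y + residue t z) ≡ residue t N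

  acceptable⇒residuesAdd₃ : ∀ {N x y z} → pAcceptable p (x ∷ y ∷ z ∷ []) → x + y + z ≡ N →
                            ResiduesAdd N x y z
  acceptable⇒residuesAdd₃ {N} {x} {y} {z} acc x+y+z≡N t = begin
    residue t x + (residue t y + residue t z)
      ≡⟨ cong (λ r → residue t x + (residue t y + r)) (+-identityʳ _) ⟨
    sum (map (residue t) (x ∷ y ∷ z ∷ []))
      ≡⟨ acceptable⇒residuesAdd t (x ∷ y ∷ z ∷ []) acc ⟩
    residue t (x + (y + (z + 0)))
      ≡⟨ cong (residue t) sum≡N ⟩
    residue t N  ∎
    where
    open ≡-Reasoning
    sum≡N : x + (y + (z + 0)) ≡ N
    sum≡N = trans (cong (λ w → x + (y + w)) (+-identityʳ z)) (trans (sym (+-assoc x y z)) x+y+z≡N)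

  residue≡0⇒∣ : ∀ e {x} → residue e x ≡ 0 → p ^ e ∣ x
  residue≡0⇒∣ e {x} = m%n≡0⇒n∣m x (p ^ e) {{m^n≢0 p e}}

  residue≡0⇒2∣ : p ≡ 2 → ∀ {x} → residue 1 x ≡ 0 → 2 ∣ x
  residue≡0⇒2∣ p≡2 {x} r = subst (_∣ x) (trans (*-identityʳ p) p≡2) (residue≡0⇒∣ 1 r)

  twoZero⇒∣ : ∀ e {x y z} → TwoOf (λ w → residue e w ≡ 0) x y z → TwoOf (p ^ e ∣_) x y z
  twoZero⇒∣ e = TwoOf-map (λ {w} → residue≡0⇒∣ e {w})

  oneZero⇒∣ : ∀ e {x y z} → OneOf (λ w → residue e w ≡ 0) x y z → OneOf (p ^ e ∣_) x y z
  oneZero⇒∣ e = OneOf-map (λ {w} → residue≡0⇒∣ e {w})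

  residues-tail≤ : ∀ {N x y z r} → ResiduesAdd N x y z → ∀ t → residue t N ≡ r →
                   residue t y + residue t z ≤ r
  residues-tail≤ {x = x} H t r = ≤-trans (m≤n+m _ (residue t x)) (≤-reflexive (trans (H t) r))

  2∥N⇒∣product : ∀ {N x y z} e → p ≡ 2 → 1 < e → residue 1 N ≡ 0 → residue e N ≡ 2 →
                 ResiduesAdd N x y z → p ^ (3 + e) ∣ x * (y * z)
  2∥N⇒∣product {x = x} {y} {z} e p≡2 1<e r₁ rₑ H =
    ∣-trans (m^n∣m^o p 3+e≤1+[e+e]) (subst (_∣ x * (y * z)) 2[q*q]≡p^[1+[e+e]]
      (TwoOf⇒∣product (twoZero⇒∣ e {x} {y} {z}
        (sum≡d⇒twoZero (2∣r 2∣x) (2∣r 2∣y) (2∣r 2∣z) (trans (H e) rₑ))) 2∣x 2∣y 2∣z))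
    where
    instance _ = m^n≢0 p e
    evens = sum≡0⇒allZero (trans (H 1) r₁)
    2∣x = residue≡0⇒2∣ p≡2 (proj₁ evens)
    2∣y = residue≡0⇒2∣ p≡2 (proj₁ (proj₂ evens))
    2∣z = residue≡0⇒2∣ p≡2 (proj₂ (proj₂ evens))
    2∣r : ∀ {w} → 2 ∣ w → 2 ∣ residue e w
    2∣r 2∣w = %-presˡ-∣ 2∣w (∣-trans (divides 2 refl) (4∣p^e p≡2 1<e))
    2[q*q]≡p^[1+[e+e]] : 2 * (p ^ e * p ^ e) ≡ p ^ (1 + (e + e))
    2[q*q]≡p^[1+[e+e]] = trans (cong (_* (p ^ e * p ^ e)) (sym p≡2)) (cong (p *_) (sym (p^[e+e] e)))
    3+e≤1+[e+e] : 3 + e ≤ 1 + (e + e)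
    3+e≤1+[e+e] = s≤s (subst (_≤ e + e) (+-comm e 2) (+-monoʳ-≤ e 1<e))

  2∥N-2⇒∣product : ∀ {N x y z} e → residue e N ≡ 0 → residue (suc e) N ≡ p ^ e →
                   ResiduesAdd N x y z → p ^ suc (e + (e + e)) ∣ x * (y * z)
  2∥N-2⇒∣product {x = x} {y} {z} e r₀ rₑ₊₁ H =
    subst (_∣ x * (y * z)) (sym p^[1+e+[e+e]])
      (OneOf⇒∣product (oneZero⇒∣ (suc e) {x} {y} {z} (TwoOf⇒OneOf {P = _≡ 0}
        (sum≡d⇒twoZero (q∣r q∣x) (q∣r q∣y) (q∣r q∣z) (trans (H (suc e)) rₑ₊₁)))) q∣x q∣y q∣z)
    where
    instance _ = m^n≢0 p e
    instance _ = m^n≢0 p (suc e)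
    zeros = sum≡0⇒allZero (trans (H e) r₀)
    q∣x = residue≡0⇒∣ e (proj₁ zeros)
    q∣y = residue≡0⇒∣ e (proj₁ (proj₂ zeros))
    q∣z = residue≡0⇒∣ e (proj₂ (proj₂ zeros))
    q∣r : ∀ {w} → p ^ e ∣ w → p ^ e ∣ residue (suc e) w
    q∣r q∣w = %-presˡ-∣ q∣w (∣n⇒∣m*n p ∣-refl)
    p^[1+e+[e+e]] : p ^ suc (e + (e + e)) ≡ p ^ suc e * (p ^ e * p ^ e)
    p^[1+e+[e+e]] = trans (cong (p *_) (p^[e+[e+e]] e)) (sym (*-assoc p (p ^ e) _))

  situation⇒∣product : ∀ {N C x y z} → Situation N C → ResiduesAdd N x y z → p ^ C ∣ x * (y * z)
  situation⇒∣product coprime _ = 1∣ _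
  situation⇒∣product {x = x} {y} {z} (p∣N e _ _ r) H with sum≡0⇒allZero (trans (H e) r)
  ... | rx , ry , rz = subst (_∣ x * (y * z)) (sym (p^[e+[e+e]] e))
        (*-pres-∣₃ (residue≡0⇒∣ e rx) (residue≡0⇒∣ e ry) (residue≡0⇒∣ e rz))
  situation⇒∣product {x = x} {y} {z} (p∣N-1 e _ r) H =
    subst (_∣ x * (y * z)) (trans (*-identityˡ _) (sym (p^[e+e] e)))
      (TwoOf⇒∣product (twoZero⇒∣ e {x} {y} {z} (sum≡1⇒twoZero _ _ _ (trans (H e) r)))
                      (1∣ x) (1∣ y) (1∣ z))
  situation⇒∣product {x = x} {y} {z} (p∣N-2 e _ _ r) H =
    subst (_∣ x * (y * z)) (*-identityʳ (p ^ e))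
      (OneOf⇒∣product (oneZero⇒∣ e {x} {y} {z} (sum≤2⇒oneZero _ _ _ (≤-reflexive (trans (H e) r))))
                      (1∣ x) (1∣ y) (1∣ z))
  situation⇒∣product (2∥N e p≡2 1<e r₁ rₑ) H = 2∥N⇒∣product e p≡2 1<e r₁ rₑ H
  situation⇒∣product (2∥N-2 e _ _ r₀ rₑ₊₁) H = 2∥N-2⇒∣product e r₀ rₑ₊₁ H

  situation⇒∣table : ∀ {N C x i j E} → (∀ q .{{_ : NonZero q}} → 1 < q → TableBound i j E q) →
                     Situation N C → ResiduesAdd N x i j → p ^ C ∣ E
  situation⇒∣table tb coprime _ = 1∣ _
  situation⇒∣table {x = x} {E = E} tb (p∣N e q>1 odd r) H =
    subst (_∣ E) (sym (p^[e+[e+e]] e))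
      (proj₁ (tb (p ^ e) {{m^n≢0 p e}} q>1) odd (m+n≡0⇒n≡0 (residue e x) (trans (H e) r)))
  situation⇒∣table {E = E} tb (p∣N-1 e q>1 r) H =
    subst (_∣ E) (sym (p^[e+e] e))
      (proj₁ (proj₂ (tb (p ^ e) {{m^n≢0 p e}} q>1)) (residues-tail≤ H e r))
  situation⇒∣table tb (p∣N-2 e q>1 odd r) H =
    proj₁ (proj₂ (proj₂ (tb (p ^ e) {{m^n≢0 p e}} q>1))) odd (residues-tail≤ H e r)
  situation⇒∣table {x = x} {E = E} tb (2∥N e p≡2 1<e r₁ rₑ) H =
    subst (_∣ E) 8q≡p^[3+e]
      (proj₁ (proj₂ (proj₂ (proj₂ (tb (p ^ e) {{m^n≢0 p e}} (1<p^e e (<-trans (s≤s z≤n) 1<e))))))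
        (4∣p^e p≡2 1<e) (2∣ (proj₁ evens)) (2∣ (proj₂ evens)) (residues-tail≤ H e rₑ))
    where
    2∣ = residue≡0⇒2∣ p≡2
    evens = proj₂ (sum≡0⇒allZero {residue 1 x} (trans (H 1) r₁))
    regroup : ∀ q → 8 * q ≡ 2 * (2 * (2 * q))
    regroup = solve-∀
    8q≡p^[3+e] : 8 * p ^ e ≡ p ^ (3 + e)
    8q≡p^[3+e] = trans (regroup (p ^ e)) (cong (λ b → b * (b * (b * p ^ e))) (sym p≡2))
  situation⇒∣table {x = x} {E = E} tb (2∥N-2 e p≡2 1<e r₀ _) H =
    subst (_∣ E) 2q³≡p^[1+3e]
      (proj₂ (proj₂ (proj₂ (proj₂ (tb (p ^ e) {{m^n≢0 p e}} (1<p^e e (<-trans (s≤s z≤n) 1<e))))))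
        (4∣p^e p≡2 1<e) (m+n≡0⇒n≡0 (residue e x) (trans (H e) r₀)))
    where
    2q³≡p^[1+3e] : 2 * (p ^ e * (p ^ e * p ^ e)) ≡ p ^ suc (e + (e + e))
    2q³≡p^[1+3e] = trans (cong (_* (p ^ e * (p ^ e * p ^ e))) (sym p≡2))
                         (cong (p *_) (sym (p^[e+[e+e]] e)))

N³*table<729[N-1]²[N-2] : ∀ {n i j} → InRange i j → i + j < 3 + n →
  (3 + n) * (3 + n) * (3 + n) * table i j < 729 * ((2 + n) * (2 + n) * (1 + n))
N³*table<729[N-1]²[N-2] {n} {i} {j} range i+j<N =
  subst₂ _<_ (lhs n E) (rhs n)
    (subst (λ a → E * ((a + 2) * (a + 2) * (a + 2)) < 729 * ((a + 1) * (a + 1) * a)) m+k≡1+n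
      (sizeBound⇒inequality {m} (proj₂ (tableSize range)) k))
  where
  E = table i j
  m = i + j ∸ 1
  k = 1 + n ∸ m
  m+k≡1+n : m + k ≡ 1 + n
  m+k≡1+n = m+[n∸m]≡n (∸-monoˡ-≤ 1 (≤-pred i+j<N))
  lhs : ∀ n E → E * ((1 + n + 2) * (1 + n + 2) * (1 + n + 2)) ≡ (3 + n) * (3 + n) * (3 + n) * E
  lhs = solve-∀
  rhs : ∀ n → 729 * ((1 + n + 1) * (1 + n + 1) * (1 + n)) ≡ 729 * ((2 + n) * (2 + n) * (1 + n))
  rhs = solve-∀

weight≤⇒729[N-1]²[N-2]≤N³*E : ∀ {n} a₁ a₂ a₃ b₁ b₂ b₃ {E} →
  a₁ + a₂ + a₃ ≡ 3 + n → b₁ + b₂ + b₃ ≡ 3 + n →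
  weight (3 + n) ≤ a₁ * (a₂ * a₃) * (b₁ * (b₂ * b₃) * E) →
  729 * ((2 + n) * (2 + n) * (1 + n)) ≤ (3 + n) * (3 + n) * (3 + n) * E
weight≤⇒729[N-1]²[N-2]≤N³*E {n} a₁ a₂ a₃ b₁ b₂ b₃ {E} a-sum b-sum weight≤ = *-cancelˡ-≤ N³ (begin
  N³ * (729 * D)           ≡⟨ regroup₁ (3 + n) (2 + n) (1 + n) ⟩
  729 * weight (3 + n)     ≤⟨ *-monoʳ-≤ 729 weight≤ ⟩
  729 * (Pa * (Pb * E))    ≡⟨ regroup₂ Pa Pb E ⟩
  27 * Pa * (27 * Pb * E)  ≤⟨ *-mono-≤ (amgm a₁ a₂ a₃ a-sum) (*-monoˡ-≤ E (amgm b₁ b₂ b₃ b-sum)) ⟩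
  N³ * (N³ * E)            ∎)
  where
  open ≤-Reasoning
  N³ = (3 + n) * (3 + n) * (3 + n)
  D = (2 + n) * (2 + n) * (1 + n)
  Pa = a₁ * (a₂ * a₃)
  Pb = b₁ * (b₂ * b₃)
  regroup₁ : ∀ a b c → a * a * a * (729 * (b * b * c)) ≡ 729 * (a * a * a * b * b * c)
  regroup₁ = solve-∀
  regroup₂ : ∀ a b e → 729 * (a * (b * e)) ≡ 27 * a * (27 * b * e)
  regroup₂ = solve-∀
  amgm : ∀ x y z → x + y + z ≡ 3 + n → 27 * (x * (y * z)) ≤ N³
  amgm x y z sum≡N = subst (λ s → 27 * (x * (y * z)) ≤ s * s * s) sum≡N (27abc≤[a+b+c]³ x y z)

p∣weight⇒p∣N[N-1][N-2] : ∀ {p N} → Prime p → p ∣ weight N → p ∣ N * (N ∸ 1) * (N ∸ 2)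
p∣weight⇒p∣N[N-1][N-2] {p} {N} p-prime p∣weight
  with euclidsLemma _ _ p-prime (∣-trans p∣weight (divides ((N ∸ 1) * ((N ∸ 2) * (N ∸ 2)))
                                                          (regroup N (N ∸ 1) (N ∸ 2))))
  where regroup : ∀ a b c → a * b * c * (a * b * c * (a * b * c))
                            ≡ b * (c * c) * (a * a * a * b * b * c)
        regroup = solve-∀
... | inj₁ p∣T  = p∣T
... | inj₂ p∣T² = [ (λ p∣T → p∣T) , (λ p∣T → p∣T) ]′ (euclidsLemma _ _ p-prime p∣T²)

weight≢0 : ∀ n → NonZero (weight (3 + n))
weight≢0 n = m*n≢0 (N * N * N * M * M) (1 + n)
  {{m*n≢0 (N * N * N * M) M {{m*n≢0 (N * N * N) M {{m*n≢0 (N * N) N {{m*n≢0 N N}}}}}}}}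
  where N = 3 + n
        M = 2 + n

N∸i∸j+i+j≡N : ∀ {N} i j → i + j ≤ N → N ∸ i ∸ j + i + j ≡ N
N∸i∸j+i+j≡N {N} i j i+j≤N =
  trans (+-assoc (N ∸ i ∸ j) i j) (trans (cong (_+ (i + j)) (∸-+-assoc N i j)) (m∸n+n≡m i+j≤N))

OneAcceptable : ℕ → List ℕ → List ℕ → List ℕ → Set
OneAcceptable p cs ds es = pAcceptable p cs ⊎ pAcceptable p ds ⊎ pAcceptable p es

weight∣product : ∀ {n i j} a₁ a₂ a₃ b₁ b₂ b₃ → InRange i j → i + j < 3 + n →
  a₁ + a₂ + a₃ ≡ 3 + n → b₁ + b₂ + b₃ ≡ 3 + n →
  (∀ p → Prime p → p ∣ (3 + n) * (2 + n) * (1 + n) →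
     OneAcceptable p ((3 + n ∸ i ∸ j) ∷ i ∷ j ∷ []) (a₁ ∷ a₂ ∷ a₃ ∷ []) (b₁ ∷ b₂ ∷ b₃ ∷ [])) →
  weight (3 + n) ∣ a₁ * (a₂ * a₃) * (b₁ * (b₂ * b₃) * table i j)
weight∣product {n} {i} {j} a₁ a₂ a₃ b₁ b₂ b₃ range i+j<N a-sum b-sum H =
  ∣-byPrimePowers {{weight≢0 n}} p^t∣
  where
  Pa = a₁ * (a₂ * a₃)
  Pb = b₁ * (b₂ * b₃)
  R = Pa * (Pb * table i j)
  p^t∣ : ∀ p t → Prime p → p ^ t ∣ weight (3 + n) → p ^ t ∣ R
  p^t∣ p zero    _       _ = 1∣ R
  p^t∣ p (suc t) p-prime p^t∣weight with Situations.weight-split p-prime n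
  ... | C , U , weight≡ , p∤U , situation = ∣-trans p^t∣p^C (p^C∣R (H p p-prime p∣N[N-1][N-2]))
    where
    open Situations p-prime
    p∣N[N-1][N-2] = p∣weight⇒p∣N[N-1][N-2] {N = 3 + n} p-prime
                      (∣-trans (∣m⇒∣m*n (p ^ t) ∣-refl) p^t∣weight)
    p^t∣p^C : p ^ suc t ∣ p ^ C
    p^t∣p^C = p^t∣m*n⇒p^t∣n p-prime (suc t) p∤U
                (subst (p ^ suc t ∣_) (trans weight≡ (*-comm (p ^ C) U)) p^t∣weight)
    p^C∣R : OneAcceptable p ((3 + n ∸ i ∸ j) ∷ i ∷ j ∷ []) (a₁ ∷ a₂ ∷ a₃ ∷ []) (b₁ ∷ b₂ ∷ b₃ ∷ []) →
            p ^ C ∣ R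
    p^C∣R (inj₁ acc) = ∣n⇒∣m*n Pa (∣n⇒∣m*n Pb (situation⇒∣table (tableBound range) situation
      (acceptable⇒residuesAdd₃ {x = 3 + n ∸ i ∸ j} acc (N∸i∸j+i+j≡N i j (<⇒≤ i+j<N)))))
    p^C∣R (inj₂ (inj₁ acc)) = ∣m⇒∣m*n (Pb * table i j)
      (situation⇒∣product situation (acceptable⇒residuesAdd₃ {x = a₁} {a₂} {a₃} acc a-sum))
    p^C∣R (inj₂ (inj₂ acc)) = ∣n⇒∣m*n Pa (∣m⇒∣m*n (table i j)
      (situation⇒∣product situation (acceptable⇒residuesAdd₃ {x = b₁} {b₂} {b₃} acc b-sum)))

proposition7p3 : ∀ (N i j a₁ a₂ a₃ b₁ b₂ b₃ : ℕ) →
    0 < i → 0 < j → i + j < N →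
    0 < a₁ → 0 < a₂ → 0 < a₃ → a₁ + a₂ + a₃ ≡ N →
    0 < b₁ → 0 < b₂ → 0 < b₃ → b₁ + b₂ + b₃ ≡ N →
    (∀ p → Prime p → p ∣ N * (N ∸ 1) * (N ∸ 2) →
      pAcceptable p ((N ∸ i ∸ j) ∷ i ∷ j ∷ [])
        ⊎ pAcceptable p (a₁ ∷ a₂ ∷ a₃ ∷ [])
        ⊎ pAcceptable p (b₁ ∷ b₂ ∷ b₃ ∷ [])) →
    ¬ (2 < i + j × i + j < 11)
proposition7p3 N i j a₁ a₂ a₃ b₁ b₂ b₃ 0<i 0<j i+j<N a₁>0 a₂>0 a₃>0 a-sum b₁>0 b₂>0 b₃>0 b-sum H
               (2<i+j , i+j<11) with <-trans 2<i+j i+j<N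
... | s≤s (s≤s (s≤s (z≤n {n}))) =
  <⇒≱ (N³*table<729[N-1]²[N-2] range i+j<N)
      (weight≤⇒729[N-1]²[N-2]≤N³*E a₁ a₂ a₃ b₁ b₂ b₃ a-sum b-sum
        (∣⇒≤ {{product≢0}} (weight∣product a₁ a₂ a₃ b₁ b₂ b₃ range i+j<N a-sum b-sum H)))
  where
  range = 0<i , 0<j , 2<i+j , ≤-pred i+j<11
  positive₃ : ∀ {x y z} → 0 < x → 0 < y → 0 < z → NonZero (x * (y * z))
  positive₃ x>0 y>0 z>0 =
    m*n≢0 _ _ {{>-nonZero x>0}} {{m*n≢0 _ _ {{>-nonZero y>0}} {{>-nonZero z>0}}}}
  product≢0 = m*n≢0 _ _ {{positive₃ a₁>0 a₂>0 a₃>0}}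
                {{m*n≢0 _ _ {{positive₃ b₁>0 b₂>0 b₃>0}} {{>-nonZero (proj₁ (tableSize range))}}}}
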